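{- Let $\mathcal{G}$ be a loopless graph with vertex set $V$ in which there are exactly two edges between each pair of adjacent vertices, and let $\overline{\mathcal{G}}$ be obtained from $\mathcal{G}$ by adding a new vertex $x$ and a pair of parallel edges between $x$ and each $v \in V$. For each pair of adjacent vertices $u,v$ of $\overline{\mathcal{G}}$, denote the two edges between them by $l_{uv}$ and $r_{uv}$. Let $M = M(\overline{\mathcal{G}})$ with ground set $\overline{E}$, and let $(e_1,\ldots,e_n)$ be a normal ordering of $\overline{E}$. Then for $1 \le j \le n-1$: (a) $\lambda_M(\{e_1,\ldots,e_{j+1}\}) = \lambda_M(\{e_1,\ldots,e_j\}) + 1$ iff $e_{j+1} \notin \mathrm{cl}_M(\{e_1,\ldots,e_j\})$; and (b) $\lambda_M(\{e_1,\ldots,e_{j+1}\}) = \lambda_M(\{e_1,\ldots,e_j\}) - 1$ iff $e_{j+1} \notin \mathrm{cl}_M(\{e_{j+2},\ldots,e_n\})$.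
   Context: An ordering of $\overline{E}$ is normal if for each pair of adjacent vertices $u,v$ of $\overline{\mathcal{G}}$, $l_{uv}$ appears before $r_{uv}$. $\lambda_M(X) = r_M(X)+r_M(\overline{E}-X)-r_M(\overline{E})$, and $\mathrm{cl}_M$ is the closure operator of $M$. -}

module Defs where

open import Data.Nat as ℕ using (ℕ; zero; suc; _<ᵇ_)
open import Data.Nat.DivMod using (_%_; m%n<n)
open import Data.Nat.Properties using (<-trans; n<1+n)
open import Data.Fin as Fin using (Fin; zero; suc; toℕ; fromℕ<)
open import Data.Fin.Subset using (Subset; _∈_; _∉_; _⊆_; ∣_∣; ∁; _∪_; ⁅_⁆; ⊤)
open import Data.Vec using (tabulate)
open import Data.Bool using (Bool; true; false; T)
open import Data.Product using (Σ; ∃; ∃₂; _×_; _,_; proj₁; proj₂)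
open import Data.Sum using (_⊎_)
open import Data.Integer as ℤ using (ℤ; +_)
open import Relation.Nullary using (¬_)
open import Relation.Binary.PropositionalEquality using (_≡_)
open import Function.Bundles using (_↔_; Inverse)

next : ∀ {k} → Fin (suc k) → Fin (suc k)
next {k} i = fromℕ< (m%n<n (suc (toℕ i)) (suc k))

module CycleMatroid {N n : ℕ} (ends : Fin n → Fin N × Fin N) where

  Joins : Fin n → Fin N → Fin N → Set
  Joins e a b = (ends e ≡ (a , b)) ⊎ (ends e ≡ (b , a))

  -- a cycle (circuit) with edges in F: a closed walk
  -- v₀ e₀ v₁ e₁ … v_len e_len v₀ with pairwise distinct vertices and
  -- pairwise distinct edges (length suc len ≥ 1; loops and pairs of
  -- parallel edges are cycles).
  record Cycle (F : Subset n) : Set where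
    field
      len      : ℕ
      edge     : Fin (suc len) → Fin n
      vert     : Fin (suc len) → Fin N
      edge-inj : ∀ i k → edge i ≡ edge k → i ≡ k
      vert-inj : ∀ i k → vert i ≡ vert k → i ≡ k
      inF      : ∀ i → edge i ∈ F
      joins    : ∀ i → Joins (edge i) (vert i) (vert (next i))

  Independent : Subset n → Set
  Independent F = ¬ Cycle F

  HasRank : Subset n → ℕ → Set
  HasRank X k =
    (Σ (Subset n) λ F → F ⊆ X × Independent F × ∣ F ∣ ≡ k)
    × (∀ F → F ⊆ X → Independent F → ∣ F ∣ ℕ.≤ k)

  HasLambda : Subset n → ℤ → Set
  HasLambda X t = Σ ℕ λ a → Σ ℕ λ b → Σ ℕ λ c →
    HasRank X a × HasRank (∁ X) b × HasRank ⊤ c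
    × (t ≡ (+ a ℤ.+ + b) ℤ.- + c)

  InCl : Subset n → Fin n → Set
  InCl X e = Σ ℕ λ a → Σ ℕ λ b → HasRank X a × HasRank (X ∪ ⁅ e ⁆) b × a ≡ b

-- The graph 𝒢 is given by its vertex set Fin m and a (symmetric,
-- irreflexive) adjacency relation adj; between adjacent vertices there
-- are exactly two edges.  𝒢‾ has vertex set Fin (suc m), where zero is
-- the new vertex x and suc v is v ∈ V.

adjBar : ∀ {m} → (Fin m → Fin m → Bool) → Fin (suc m) → Fin (suc m) → Bool
adjBar adj zero    zero    = false
adjBar adj zero    (suc v) = true
adjBar adj (suc u) zero    = true
adjBar adj (suc u) (suc v) = adj u v

data Side : Set where
  L R : Side

-- edges of 𝒢‾: for an adjacent pair {u,v} (listed with u < v) the two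
-- parallel edges l_uv = edge u v _ _ L and r_uv = edge u v _ _ R
record EdgeBar {m : ℕ} (adj : Fin m → Fin m → Bool) : Set where
  constructor edge
  field
    u    : Fin (suc m)
    v    : Fin (suc m)
    u<v  : u Fin.< v
    isAdj : T (adjBar adj u v)
    side : Side

endsBar : ∀ {m} {adj : Fin m → Fin m → Bool} → EdgeBar adj → Fin (suc m) × Fin (suc m)
endsBar e = EdgeBar.u e , EdgeBar.v e

-- an ordering (e₁,…,eₙ) of Ē: a bijection Fin n ↔ Ē, position i ↦ e_{i+1}
Ordering : ∀ {m} → (Fin m → Fin m → Bool) → ℕ → Set
Ordering adj n = Fin n ↔ EdgeBar adj

Normal : ∀ {m} {adj : Fin m → Fin m → Bool} {n} → Ordering adj n → Set
Normal {adj = adj} ord =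
  ∀ u v (h : u Fin.< v) (a : T (adjBar adj u v)) →
    Inverse.from ord (edge u v h a L) Fin.< Inverse.from ord (edge u v h a R)

-- M(𝒢‾) with each element e_{i+1} of Ē identified with its position i
endsOrd : ∀ {m} {adj : Fin m → Fin m → Bool} {n} → Ordering adj n → Fin n → Fin (suc m) × Fin (suc m)
endsOrd ord i = endsBar (Inverse.to ord i)

-- {e₁,…,e_j} as a set of positions
prefix : ∀ {n} → ℕ → Subset n
prefix j = tabulate (λ i → toℕ i <ᵇ j)

-- position of e_{j+1} (given j+1 ≤ n, i.e. j < n)
pos : ∀ {n} j → j ℕ.< n → Fin n
pos j h = fromℕ< h

-- Put X = {e₁,…,e_j} and e = e_{j+1}.  Passing from X to X ∪ {e} raises r(X) by
-- δ₁ ∈ {0,1}, with δ₁ = 1 iff e ∉ cl(X), and lowers the rank of the complement by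
-- δ₂ ∈ {0,1}, with δ₂ = 1 iff e ∉ cl({e_{j+2},…,e_n}); r(Ē) is fixed, so λ changes by
-- δ₁ − δ₂.  The edge parallel to e sits on one side of e in the ordering, and e lies
-- in the closure of that side, so δ₁ and δ₂ are not both 1.  Hence λ rises by one
-- exactly when δ₁ = 1 and drops by one exactly when δ₂ = 1.

module Submission where

open import Defs
open import Data.Nat using (ℕ; suc; _≤_; _<_)
open import Data.Fin using (Fin)
open import Data.Fin.Subset using (∁)
open import Data.Bool using (Bool; false)
open import Data.Integer using (ℤ; _+_; _-_; 1ℤ)
open import Data.Product using (_×_)
open import Relation.Nullary using (¬_)
open import Relation.Binary.PropositionalEquality using (_≡_)
open import Function.Bundles using (_⇔_)

open import Data.Nat using (s≤s; s≤s⁻¹)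
import Data.Nat.Properties as ℕ
open import Data.Fin as Fin using (zero; suc; toℕ)
import Data.Fin.Properties as Fin
open import Data.Fin.Permutation.Components using (transpose; transpose-inverse)
open import Data.Fin.Subset
  using (Subset; inside; outside; _∈_; _∉_; _⊆_; ∣_∣; _∪_; _─_; ⁅_⁆)
open import Data.Fin.Subset.Properties
  using (_∈?_; x∈p∪q⁻; x∈p∪q⁺; x∈⁅x⁆; x∈⁅y⁆⇒x≡y; x∈∁p⇒x∉p; x∉p⇒x∈∁p;
         p─q⊆p; p─⊥≡p; ∪-identityʳ; ⊆-antisym)
open import Data.Vec using (_∷_; here; there)
open import Data.Vec.Properties using (lookup∘tabulate; []=⇒lookup; lookup⇒[]=)
open import Data.Product using (Σ; _,_; proj₁; proj₂)
open import Data.Sum using (_⊎_; inj₁; inj₂; [_,_]′)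
import Data.Sum as Sum
open import Data.Empty using (⊥-elim)
open import Data.Integer using (+_; 0ℤ)
import Data.Integer.Properties as ℤ
open import Data.Integer.Tactic.RingSolver using (solve-∀)
open import Algebra.Properties.AbelianGroup ℤ.+-0-abelianGroup using (∙-cancelˡ)
open import Relation.Nullary using (yes; no)
open import Relation.Nullary.Decidable using (dec-true; dec-false)
open import Relation.Binary.PropositionalEquality using (refl; sym; trans; cong; subst; _≢_)
open import Function using (id; _∘_)
open import Function.Definitions using (Injective)
open import Function.Bundles using (Inverse; Equivalence; mk⇔)
open import Data.Bool.Properties using (T-≡)
open import Relation.Binary.Definitions using (tri<; tri≈; tri>)
open import Function.Properties.Equivalence using () renaming (trans to ⇔-trans; sym to ⇔-sym)
open import Function.Related.TypeIsomorphisms using (¬-cong-⇔)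

private
  variable
    n : ℕ

x∈p─q⇒x∉q : ∀ {p q : Subset n} {x} → x ∈ p ─ q → x ∉ q
x∈p─q⇒x∉q {p = _ ∷ _} {outside ∷ _} here      ()
x∈p─q⇒x∉q {p = _ ∷ _} {_ ∷ _}       (there h) (there h′) = x∈p─q⇒x∉q h h′

x∈p─⁅y⁆⇒x≢y : ∀ {p : Subset n} {x y} → x ∈ p ─ ⁅ y ⁆ → x ≢ y
x∈p─⁅y⁆⇒x≢y {y = y} h refl = x∈p─q⇒x∉q h (x∈⁅x⁆ y)

∣p∣≡1+∣p─⁅x⁆∣ : ∀ {p : Subset n} {x} → x ∈ p → ∣ p ∣ ≡ suc ∣ p ─ ⁅ x ⁆ ∣
∣p∣≡1+∣p─⁅x⁆∣ {p = inside ∷ p}  {zero}  here      = cong (suc ∘ ∣_∣) (sym (p─⊥≡p p))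
∣p∣≡1+∣p─⁅x⁆∣ {p = inside ∷ p}  {suc x} (there h) = cong suc (∣p∣≡1+∣p─⁅x⁆∣ h)
∣p∣≡1+∣p─⁅x⁆∣ {p = outside ∷ p} {suc x} (there h) = ∣p∣≡1+∣p─⁅x⁆∣ h

∣p∪⁅x⁆∣≡1+∣p∣ : ∀ {p : Subset n} {x} → x ∉ p → ∣ p ∪ ⁅ x ⁆ ∣ ≡ suc ∣ p ∣
∣p∪⁅x⁆∣≡1+∣p∣ {p = outside ∷ p} {zero}  _   = cong (suc ∘ ∣_∣) (∪-identityʳ p)
∣p∪⁅x⁆∣≡1+∣p∣ {p = inside ∷ p}  {zero}  x∉p = ⊥-elim (x∉p here)
∣p∪⁅x⁆∣≡1+∣p∣ {p = inside ∷ p}  {suc x} x∉p = cong suc (∣p∪⁅x⁆∣≡1+∣p∣ (x∉p ∘ there))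
∣p∪⁅x⁆∣≡1+∣p∣ {p = outside ∷ p} {suc x} x∉p = ∣p∪⁅x⁆∣≡1+∣p∣ (x∉p ∘ there)

⊆∪⁅x⁆⇒⊆ : ∀ {p q : Subset n} {x} → p ⊆ q ∪ ⁅ x ⁆ → (∀ {y} → y ∈ p → y ≢ x) → p ⊆ q
⊆∪⁅x⁆⇒⊆ {q = q} {x} p⊆q∪x p∌x {y} y∈p with x∈p∪q⁻ q ⁅ x ⁆ (p⊆q∪x y∈p)
... | inj₁ y∈q = y∈q
... | inj₂ y∈x = ⊥-elim (p∌x y∈p (x∈⁅y⁆⇒x≡y x y∈x))

∁p≡∁[p∪⁅x⁆]∪⁅x⁆ : ∀ {p : Subset n} {x} → x ∉ p → ∁ p ≡ ∁ (p ∪ ⁅ x ⁆) ∪ ⁅ x ⁆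
∁p≡∁[p∪⁅x⁆]∪⁅x⁆ {p = p} {x} x∉p = ⊆-antisym ∁p⊆ ⊆∁p
  where
  ∁p⊆ : ∁ p ⊆ ∁ (p ∪ ⁅ x ⁆) ∪ ⁅ x ⁆
  ∁p⊆ {y} y∈∁p with y Fin.≟ x
  ... | yes refl = x∈p∪q⁺ (inj₂ (x∈⁅x⁆ x))
  ... | no y≢x = x∈p∪q⁺ (inj₁ (x∉p⇒x∈∁p λ y∈p∪x → [ x∈∁p⇒x∉p y∈∁p , y≢x ∘ x∈⁅y⁆⇒x≡y x ]′ (x∈p∪q⁻ p ⁅ x ⁆ y∈p∪x)))
  ⊆∁p : ∁ (p ∪ ⁅ x ⁆) ∪ ⁅ x ⁆ ⊆ ∁ p
  ⊆∁p {y} h with x∈p∪q⁻ (∁ (p ∪ ⁅ x ⁆)) ⁅ x ⁆ h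
  ... | inj₁ y∉p∪x = x∉p⇒x∈∁p (x∈∁p⇒x∉p y∉p∪x ∘ x∈p∪q⁺ ∘ inj₁)
  ... | inj₂ y∈x = subst (_∈ ∁ p) (sym (x∈⁅y⁆⇒x≡y x y∈x)) (x∉p⇒x∈∁p x∉p)

pair : ∀ {a} {A : Set a} → A → A → Fin 2 → A
pair x y zero       = x
pair x y (suc zero) = y

pair-injective : ∀ {a} {A : Set a} {x y : A} → x ≢ y → Injective _≡_ _≡_ (pair x y)
pair-injective _   {zero}     {zero}     _  = refl
pair-injective x≢y {zero}     {suc zero} eq = ⊥-elim (x≢y eq)
pair-injective x≢y {suc zero} {zero}     eq = ⊥-elim (x≢y (sym eq))
pair-injective _   {suc zero} {suc zero} _  = refl

transpose-≡ : ∀ (i j : Fin n) → transpose i j i ≡ j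
transpose-≡ i j rewrite dec-true (i Fin.≟ i) refl = refl

transpose-≢ : ∀ {i j k : Fin n} → k ≢ i → k ≢ j → transpose i j k ≡ k
transpose-≢ {i = i} {j} {k} k≢i k≢j
  rewrite dec-false (k Fin.≟ i) k≢i | dec-false (k Fin.≟ j) k≢j = refl

transpose-injective : ∀ (i j : Fin n) → Injective _≡_ _≡_ (transpose i j)
transpose-injective i j {x} {y} eq =
  trans (sym (transpose-inverse j i)) (trans (cong (transpose j i) eq) (transpose-inverse j i))

i+j≢i+k : ∀ i {j k} → j ≢ k → i + j ≢ i + k
i+j≢i+k i j≢k = j≢k ∘ ∙-cancelˡ i _ _

i≢i+1 : ∀ i → i ≢ i + 1ℤ
i≢i+1 i = i+j≢i+k i {0ℤ} (λ ()) ∘ trans (ℤ.+-identityʳ i)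

i≢i-1 : ∀ i → i ≢ i - 1ℤ
i≢i-1 i = i+j≢i+k i {0ℤ} (λ ()) ∘ trans (ℤ.+-identityʳ i)

i+1≢i-1 : ∀ i → i + 1ℤ ≢ i - 1ℤ
i+1≢i-1 i = i+j≢i+k i (λ ())

[1+x+y]-z≡[x+y-z]+1 : ∀ x y z → ((1ℤ + x) + y) - z ≡ ((x + y) - z) + 1ℤ
[1+x+y]-z≡[x+y-z]+1 = solve-∀

x+y-z≡[x+[1+y]-z]-1 : ∀ x y z → (x + y) - z ≡ ((x + (1ℤ + y)) - z) - 1ℤ
x+y-z≡[x+[1+y]-z]-1 = solve-∀

λ-change : ∀ {a a′ b b′ c λ₀ λ₁} → λ₀ ≡ (+ a + + b) - + c → λ₁ ≡ (+ a′ + + b′) - + c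
         → a′ ≡ a ⊎ a′ ≡ suc a → b ≡ b′ ⊎ b ≡ suc b′ → a ≡ a′ ⊎ b′ ≡ b
         → (λ₁ ≡ λ₀ + 1ℤ ⇔ a ≢ a′) × (λ₁ ≡ λ₀ - 1ℤ ⇔ b′ ≢ b)
λ-change {λ₀ = λ₀} refl refl (inj₁ refl) (inj₁ refl) _ =
  mk⇔ (⊥-elim ∘ i≢i+1 λ₀) (λ a≢a → ⊥-elim (a≢a refl)) ,
  mk⇔ (⊥-elim ∘ i≢i-1 λ₀) (λ b≢b → ⊥-elim (b≢b refl))
λ-change {a} {b = b} {c = c} {λ₀} refl refl (inj₂ refl) (inj₁ refl) _ =
  mk⇔ (λ _ → ℕ.1+n≢n ∘ sym) (λ _ → up) ,
  mk⇔ (⊥-elim ∘ i+1≢i-1 λ₀ ∘ trans (sym up)) (λ b≢b → ⊥-elim (b≢b refl))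
  where
  up : (+ suc a + + b) - + c ≡ λ₀ + 1ℤ
  up = [1+x+y]-z≡[x+y-z]+1 (+ a) (+ b) (+ c)
λ-change {a} {b′ = b′} {c} {λ₀} refl refl (inj₁ refl) (inj₂ refl) _ =
  mk⇔ (λ h → ⊥-elim (i+1≢i-1 λ₀ (trans (sym h) down))) (λ a≢a → ⊥-elim (a≢a refl)) ,
  mk⇔ (λ _ → ℕ.1+n≢n ∘ sym) (λ _ → down)
  where
  down : (+ a + + b′) - + c ≡ λ₀ - 1ℤ
  down = x+y-z≡[x+[1+y]-z]-1 (+ a) (+ b′) (+ c)
λ-change _ _ (inj₂ refl) (inj₂ refl) (inj₁ a≡1+a) = ⊥-elim (ℕ.1+n≢n (sym a≡1+a))
λ-change _ _ (inj₂ refl) (inj₂ refl) (inj₂ b≡1+b) = ⊥-elim (ℕ.1+n≢n (sym b≡1+b))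

module CycleMatroidProperties {N n : ℕ} (ends : Fin n → Fin N × Fin N) where
  open CycleMatroid ends

  Parallel : Fin n → Fin n → Set
  Parallel l e = l ≢ e × ends l ≡ ends e

  NonLoop : Fin n → Set
  NonLoop e = proj₁ (ends e) ≢ proj₂ (ends e)

  Joins-resp : ∀ {x y a b} → ends x ≡ ends y → Joins x a b → Joins y a b
  Joins-resp x~y = Sum.map (trans (sym x~y)) (trans (sym x~y))

  Cycle-map : ∀ {F G} (f : Fin n → Fin n) → Injective _≡_ _≡_ f
            → (∀ {x} → x ∈ F → f x ∈ G × ends (f x) ≡ ends x) → Cycle F → Cycle G
  Cycle-map f f-inj f-ok C = record
    { len = len ; edge = f ∘ Cycle.edge C ; vert = vert
    ; edge-inj = λ i k → edge-inj i k ∘ f-inj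
    ; vert-inj = vert-inj
    ; inF = λ i → proj₁ (f-ok (inF i))
    ; joins = λ i → Joins-resp (sym (proj₂ (f-ok (inF i)))) (joins i)
    }
    where open Cycle C

  Cycle-mono : ∀ {F G} → F ⊆ G → Cycle F → Cycle G
  Cycle-mono F⊆G = Cycle-map id id (λ x∈F → F⊆G x∈F , refl)

  parallel-cycle : ∀ {F l e} → Parallel l e → NonLoop e → l ∈ F → e ∈ F → Cycle F
  parallel-cycle {l = l} {e} (l≢e , l~e) e-nonloop l∈F e∈F = record
    { len = 1
    ; edge = pair l e ; vert = pair (proj₁ (ends e)) (proj₂ (ends e))
    ; edge-inj = λ _ _ → pair-injective l≢e
    ; vert-inj = λ _ _ → pair-injective e-nonloop
    ; inF = λ { zero → l∈F ; (suc zero) → e∈F }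
    ; joins = λ { zero → inj₁ l~e ; (suc zero) → inj₂ refl }
    }

  -- The transposition (l e) fixes the ends of every edge and carries a cycle in
  -- (F − e) + l onto a cycle in F.
  exchange-independent : ∀ {F l e} → Independent F → e ∈ F → l ∉ F → ends l ≡ ends e
                       → Independent ((F ─ ⁅ e ⁆) ∪ ⁅ l ⁆)
  exchange-independent {F} {l} {e} F-indep e∈F l∉F l~e =
    F-indep ∘ Cycle-map (transpose l e) (transpose-injective l e) swap-ok
    where
    swap-ok : ∀ {x} → x ∈ (F ─ ⁅ e ⁆) ∪ ⁅ l ⁆ → transpose l e x ∈ F × ends (transpose l e x) ≡ ends x
    swap-ok {x} x∈G with x∈p∪q⁻ (F ─ ⁅ e ⁆) ⁅ l ⁆ x∈G
    ... | inj₂ x∈l rewrite x∈⁅y⁆⇒x≡y l x∈l | transpose-≡ l e = e∈F , sym l~e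
    ... | inj₁ x∈F-e = subst (_∈ F) (sym fixed) x∈F , cong ends fixed
      where
      x∈F : x ∈ F
      x∈F = p─q⊆p F ⁅ e ⁆ x∈F-e
      fixed : transpose l e x ≡ x
      fixed = transpose-≢ (λ { refl → l∉F x∈F }) (x∈p─⁅y⁆⇒x≢y x∈F-e)

  HasRank-unique : ∀ {X a b} → HasRank X a → HasRank X b → a ≡ b
  HasRank-unique ((F , F⊆X , F-indep , ∣F∣≡a) , a-max) ((G , G⊆X , G-indep , ∣G∣≡b) , b-max) =
    ℕ.≤-antisym (subst (_≤ _) ∣F∣≡a (b-max F F⊆X F-indep))
                (subst (_≤ _) ∣G∣≡b (a-max G G⊆X G-indep))

  rank-∪⁅⁆-≥ : ∀ {X e a b} → HasRank X a → HasRank (X ∪ ⁅ e ⁆) b → a ≤ b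
  rank-∪⁅⁆-≥ ((F , F⊆X , F-indep , ∣F∣≡a) , _) (_ , b-max) =
    subst (_≤ _) ∣F∣≡a (b-max F (x∈p∪q⁺ ∘ inj₁ ∘ F⊆X) F-indep)

  rank-∪⁅⁆-≤ : ∀ {X e a b} → HasRank X a → HasRank (X ∪ ⁅ e ⁆) b → b ≤ suc a
  rank-∪⁅⁆-≤ {e = e} {a} (_ , a-max) ((F , F⊆X∪e , F-indep , ∣F∣≡b) , _) with e ∈? F
  ... | yes e∈F = subst (_≤ suc a) (trans (sym (∣p∣≡1+∣p─⁅x⁆∣ e∈F)) ∣F∣≡b)
                    (s≤s (a-max (F ─ ⁅ e ⁆) (⊆∪⁅x⁆⇒⊆ (F⊆X∪e ∘ p─q⊆p F ⁅ e ⁆) x∈p─⁅y⁆⇒x≢y)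
                                (F-indep ∘ Cycle-mono (p─q⊆p F ⁅ e ⁆))))
  ... | no e∉F = ℕ.m≤n⇒m≤1+n (subst (_≤ a) ∣F∣≡b
                    (a-max F (⊆∪⁅x⁆⇒⊆ F⊆X∪e λ { x∈F refl → e∉F x∈F }) F-indep))

  rank-∪⁅⁆-parallel : ∀ {X l e a b} → l ∈ X → Parallel l e → NonLoop e
                    → HasRank X a → HasRank (X ∪ ⁅ e ⁆) b → b ≤ a
  rank-∪⁅⁆-parallel {X} {l} {e} {a} {b} l∈X l∥e e-nonloop
    (_ , a-max) ((F , F⊆X∪e , F-indep , ∣F∣≡b) , _) with e ∈? F | l ∈? F
  ... | no e∉F | _ = subst (_≤ a) ∣F∣≡b (a-max F (⊆∪⁅x⁆⇒⊆ F⊆X∪e λ { x∈F refl → e∉F x∈F }) F-indep)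
  ... | yes e∈F | yes l∈F = ⊥-elim (F-indep (parallel-cycle l∥e e-nonloop l∈F e∈F))
  ... | yes e∈F | no l∉F = subst (_≤ a) ∣G∣≡b
        (a-max G G⊆X (exchange-independent F-indep e∈F l∉F (proj₂ l∥e)))
    where
    G : Subset n
    G = (F ─ ⁅ e ⁆) ∪ ⁅ l ⁆
    ∣G∣≡b : ∣ G ∣ ≡ b
    ∣G∣≡b = trans (∣p∪⁅x⁆∣≡1+∣p∣ (l∉F ∘ p─q⊆p F ⁅ e ⁆))
                  (trans (sym (∣p∣≡1+∣p─⁅x⁆∣ e∈F)) ∣F∣≡b)
    G⊆X : G ⊆ X
    G⊆X x∈G with x∈p∪q⁻ (F ─ ⁅ e ⁆) ⁅ l ⁆ x∈G
    ... | inj₁ x∈F-e = ⊆∪⁅x⁆⇒⊆ (F⊆X∪e ∘ p─q⊆p F ⁅ e ⁆) x∈p─⁅y⁆⇒x≢y x∈F-e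
    ... | inj₂ x∈l = subst (_∈ X) (sym (x∈⁅y⁆⇒x≡y l x∈l)) l∈X

  rank-∪⁅⁆ : ∀ {X e a b} → HasRank X a → HasRank (X ∪ ⁅ e ⁆) b → b ≡ a ⊎ b ≡ suc a
  rank-∪⁅⁆ rX rX∪e with ℕ.m≤n⇒m<n∨m≡n (rank-∪⁅⁆-≤ rX rX∪e)
  ... | inj₁ b<1+a = inj₁ (ℕ.≤-antisym (s≤s⁻¹ b<1+a) (rank-∪⁅⁆-≥ rX rX∪e))
  ... | inj₂ b≡1+a = inj₂ b≡1+a

  HasParallelIn : Subset n → Fin n → Set
  HasParallelIn X e = Σ (Fin n) λ l → l ∈ X × Parallel l e

  rank-∪⁅⁆-stays : ∀ {X e a b} → HasParallelIn X e → NonLoop e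
                 → HasRank X a → HasRank (X ∪ ⁅ e ⁆) b → a ≡ b
  rank-∪⁅⁆-stays (l , l∈X , l∥e) e-nonloop rX rX∪e =
    ℕ.≤-antisym (rank-∪⁅⁆-≥ rX rX∪e) (rank-∪⁅⁆-parallel l∈X l∥e e-nonloop rX rX∪e)

  InCl⇔rank-≡ : ∀ {X e a b} → HasRank X a → HasRank (X ∪ ⁅ e ⁆) b → InCl X e ⇔ a ≡ b
  InCl⇔rank-≡ rX rX∪e = mk⇔
    (λ (_ , _ , rX′ , rX∪e′ , a′≡b′) →
       trans (HasRank-unique rX rX′) (trans a′≡b′ (HasRank-unique rX∪e′ rX∪e)))
    (λ a≡b → _ , _ , rX , rX∪e , a≡b)

  λ-∪⁅⁆ : ∀ {X e λ₀ λ₁} → e ∉ X → NonLoop e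
        → HasParallelIn X e ⊎ HasParallelIn (∁ (X ∪ ⁅ e ⁆)) e
        → HasLambda X λ₀ → HasLambda (X ∪ ⁅ e ⁆) λ₁
        → ((λ₁ ≡ λ₀ + 1ℤ) ⇔ (¬ InCl X e)) × ((λ₁ ≡ λ₀ - 1ℤ) ⇔ (¬ InCl (∁ (X ∪ ⁅ e ⁆)) e))
  λ-∪⁅⁆ {X} {e} {λ₀} {λ₁} e∉X e-nonloop parallel
    (a , b , c , rX , r∁X , rE , λ₀≡) (a′ , b′ , _ , rY , r∁Y , rE′ , λ₁≡)
    rewrite HasRank-unique rE′ rE =
      ⇔-trans (proj₁ Δλ) (⇔-sym (¬-cong-⇔ (InCl⇔rank-≡ rX rY))) ,
      ⇔-trans (proj₂ Δλ) (⇔-sym (¬-cong-⇔ (InCl⇔rank-≡ r∁Y r∁Y∪e)))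
    where
    r∁Y∪e : HasRank (∁ (X ∪ ⁅ e ⁆) ∪ ⁅ e ⁆) b
    r∁Y∪e = subst (λ Z → HasRank Z b) (∁p≡∁[p∪⁅x⁆]∪⁅x⁆ e∉X) r∁X
    one-stays : a ≡ a′ ⊎ b′ ≡ b
    one-stays = Sum.map (λ p → rank-∪⁅⁆-stays p e-nonloop rX rY)
                        (λ p → rank-∪⁅⁆-stays p e-nonloop r∁Y r∁Y∪e) parallel
    Δλ : (λ₁ ≡ λ₀ + 1ℤ ⇔ a ≢ a′) × (λ₁ ≡ λ₀ - 1ℤ ⇔ b′ ≢ b)
    Δλ = λ-change {c = c} λ₀≡ λ₁≡ (rank-∪⁅⁆ rX rY) (rank-∪⁅⁆ r∁Y r∁Y∪e) one-stays

∈-prefix⇔ : ∀ {k} {i : Fin n} → i ∈ prefix k ⇔ toℕ i < k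
∈-prefix⇔ {k = k} {i} = mk⇔
  (λ i∈ → ℕ.<ᵇ⇒< _ _ (Equivalence.from T-≡ (trans (sym (lookup∘tabulate _ i)) ([]=⇒lookup i∈))))
  (λ i<k → lookup⇒[]= i (prefix k) (trans (lookup∘tabulate _ i) (Equivalence.to T-≡ (ℕ.<⇒<ᵇ i<k))))

module _ (j : ℕ) (j<n : j < n) where

  toℕ-pos : toℕ (pos j j<n) ≡ j
  toℕ-pos = Fin.toℕ-fromℕ< j<n

  pos∉prefix : pos j j<n ∉ prefix j
  pos∉prefix = ℕ.<-irrefl toℕ-pos ∘ Equivalence.to ∈-prefix⇔

  prefix-suc : prefix (suc j) ≡ prefix j ∪ ⁅ pos j j<n ⁆
  prefix-suc = ⊆-antisym ⊆prefix∪pos prefix∪pos⊆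
    where
    ⊆prefix∪pos : prefix (suc j) ⊆ prefix j ∪ ⁅ pos j j<n ⁆
    ⊆prefix∪pos i∈ with ℕ.m<1+n⇒m<n∨m≡n (Equivalence.to ∈-prefix⇔ i∈)
    ... | inj₁ i<j = x∈p∪q⁺ (inj₁ (Equivalence.from ∈-prefix⇔ i<j))
    ... | inj₂ i≡j rewrite Fin.toℕ-injective (trans i≡j (sym toℕ-pos)) = x∈p∪q⁺ (inj₂ (x∈⁅x⁆ _))
    prefix∪pos⊆ : prefix j ∪ ⁅ pos j j<n ⁆ ⊆ prefix (suc j)
    prefix∪pos⊆ i∈ with x∈p∪q⁻ (prefix j) ⁅ pos j j<n ⁆ i∈
    ... | inj₁ i∈prefix = Equivalence.from ∈-prefix⇔ (ℕ.m<n⇒m<1+n (Equivalence.to ∈-prefix⇔ i∈prefix))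
    ... | inj₂ i∈pos rewrite x∈⁅y⁆⇒x≡y _ i∈pos = Equivalence.from ∈-prefix⇔ (ℕ.≤-reflexive (cong suc toℕ-pos))

  ≢pos⇒before⊎after : ∀ {i} → i ≢ pos j j<n → i ∈ prefix j ⊎ i ∈ ∁ (prefix j ∪ ⁅ pos j j<n ⁆)
  ≢pos⇒before⊎after {i} i≢pos with ℕ.<-cmp (toℕ i) j
  ... | tri< i<j _ _ = inj₁ (Equivalence.from ∈-prefix⇔ i<j)
  ... | tri≈ _ i≡j _ = ⊥-elim (i≢pos (Fin.toℕ-injective (trans i≡j (sym toℕ-pos))))
  ... | tri> _ _ j<i = inj₂ (x∉p⇒x∈∁p
    (ℕ.<⇒≱ j<i ∘ s≤s⁻¹ ∘ Equivalence.to ∈-prefix⇔ ∘ subst (i ∈_) (sym prefix-suc)))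

flip : Side → Side
flip L = R
flip R = L

flip-≢ : ∀ s → flip s ≢ s
flip-≢ L ()
flip-≢ R ()

module _ {m : ℕ} {adj : Fin m → Fin m → Bool} where

  partner : EdgeBar adj → EdgeBar adj
  partner (edge u v u<v u~v s) = edge u v u<v u~v (flip s)

  partner-≢ : ∀ ε → partner ε ≢ ε
  partner-≢ (edge _ _ _ _ s) = flip-≢ s ∘ cong EdgeBar.side

  module _ {n : ℕ} (ord : Ordering adj n) where
    open Inverse ord using (to; from; strictlyInverseˡ)
    open CycleMatroidProperties (endsOrd ord)

    endsOrd-nonLoop : ∀ i → NonLoop i
    endsOrd-nonLoop i = Fin.<⇒≢ (EdgeBar.u<v (to i))

    partner-parallel : ∀ i → Parallel (from (partner (to i))) i
    partner-parallel i =
      (λ eq → partner-≢ (to i) (trans (sym (strictlyInverseˡ _)) (cong to eq))) ,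
      cong endsBar (strictlyInverseˡ (partner (to i)))

    parallel-before⊎after : ∀ j (j<n : j < n)
      → HasParallelIn (prefix j) (pos j j<n) ⊎ HasParallelIn (∁ (prefix j ∪ ⁅ pos j j<n ⁆)) (pos j j<n)
    parallel-before⊎after j j<n =
      Sum.map (λ p∈ → p , p∈ , p∥e) (λ p∈ → p , p∈ , p∥e) (≢pos⇒before⊎after j j<n (proj₁ p∥e))
      where
      p : Fin n
      p = from (partner (to (pos j j<n)))
      p∥e : Parallel p (pos j j<n)
      p∥e = partner-parallel (pos j j<n)

lemma3p7 : (m : ℕ) (adj : Fin m → Fin m → Bool)
    → (∀ u v → adj u v ≡ adj v u) → (∀ u → adj u u ≡ false)
    → (n : ℕ) (ord : Ordering adj n) → Normal ord
    → (j : ℕ) → 1 ≤ j → (h : j < n)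
    → let open CycleMatroid (endsOrd ord) in
      (lj lj1 : ℤ) → HasLambda (prefix j) lj → HasLambda (prefix (suc j)) lj1
    → ((lj1 ≡ lj + 1ℤ) ⇔ (¬ InCl (prefix j) (pos j h)))
      × ((lj1 ≡ lj - 1ℤ) ⇔ (¬ InCl (∁ (prefix (suc j))) (pos j h)))
lemma3p7 _ _ _ _ _ ord _ j _ h _ _ rewrite prefix-suc j h =
  λ-∪⁅⁆ (pos∉prefix j h) (endsOrd-nonLoop ord (pos j h)) (parallel-before⊎after ord j h)
  where open CycleMatroidProperties (endsOrd ord)
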